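{- For all $a,b \in \mathbb N$ with $a+b\le q$, we have \begin{equation*}x_{a(q-1)}\sqcup\!\sqcup x_{b(q-1)} = \underbrace{x_{q-1}\sqcup\!\sqcup \dots \sqcup\!\sqcup x_{q-1}}_{a+b} = x_{(a+b)(q-1)}. \end{equation*}
   Context: Let $\mathbb F_q$ be the finite field with $q$ elements, of characteristic $p$. Let $\Sigma=\{x_n\}_{n\geq 1}$ be an alphabet; let $\langle\Sigma\rangle$ be the set of words over $\Sigma$ (the empty word is denoted $1$), and let $\mathfrak C=\mathbb F_q\langle\Sigma\rangle$ be the $\mathbb F_q$-vector space with basis $\langle\Sigma\rangle$. A nonempty word is written $\mathfrak a=x_a\mathfrak a_-$. For $a,b,i\in\mathbb N$ put $\Delta^i_{a,b}=(-1)^{a-1}\binom{i-1}{a-1}+(-1)^{b-1}\binom{i-1}{b-1}\in\mathbb F_p$ if $(q-1)\mid i$ and $0<i<a+b$, and $\Delta^i_{a,b}=0$ otherwise. Define $\mathbb F_q$-bilinear products $\diamond$ (diamond) and $\sqcup\!\sqcup$ (shuffle) on $\mathfrak C$ recursively by $1\diamond\mathfrak a=\mathfrak a\diamond 1=\mathfrak a$, $1\sqcup\!\sqcup\mathfrak a=\mathfrak a\sqcup\!\sqcup 1=\mathfrak a$, and for nonempty words $\mathfrak a,\mathfrak b$: $\mathfrak a\diamond\mathfrak b=x_{a+b}(\mathfrak a_-\sqcup\!\sqcup\mathfrak b_-)+\sum_{i+j=a+b}\Delta^j_{a,b}\,x_i(x_j\sqcup\!\sqcup(\mathfrak a_-\sqcup\!\sqcup\mathfrak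 b_-))$, $\mathfrak a\sqcup\!\sqcup\mathfrak b=x_a(\mathfrak a_-\sqcup\!\sqcup\mathfrak b)+x_b(\mathfrak a\sqcup\!\sqcup\mathfrak b_-)+\mathfrak a\diamond\mathfrak b$ (a commutative associative product). -}

module Defs where

open import Data.Nat as ℕ using (ℕ; zero; suc; _∸_; _<?_)
open import Data.Nat.Divisibility using (_∣?_)
open import Data.Nat.Combinatorics using (_C_)
open import Data.Integer as ℤ using (ℤ; +_; 0ℤ; 1ℤ; -_)
open import Data.Integer.Divisibility as ℤD using ()
open import Data.List using (List; []; _∷_; _++_; map; concatMap; upTo)
open import Data.List.Properties using (≡-dec)
open import Data.Product using (_×_; _,_)
open import Relation.Nullary using (yes; no)

-- A word over Σ = {x_n}: the list of indices n.  The empty list is the empty word 1.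
Word : Set
Word = List ℕ

-- An element of the free vector space over words, as a finite formal sum
-- Σ c · w with integer coefficients (all structure constants lie in the prime
-- field 𝔽_p = ℤ/p, which sits inside 𝔽_q; equality is taken modulo p, see _≈[_]_).
Poly : Set
Poly = List (ℤ × Word)

word : Word → Poly
word w = (1ℤ , w) ∷ []

scale : ℤ → Poly → Poly
scale c = map (λ { (d , w) → (c ℤ.* d , w) })

pre : ℕ → Poly → Poly
pre n = map (λ { (d , w) → (d , n ∷ w) })

sgn : ℕ → ℤ
sgn zero = 1ℤ
sgn (suc n) = - sgn n

Δ : ℕ → ℕ → ℕ → ℕ → ℤ
Δ q a b i with (q ∸ 1) ∣? i | 0 <? i | i <? a ℕ.+ b
... | yes _ | yes _ | yes _ =
  sgn (a ∸ 1) ℤ.* + ((i ∸ 1) C (a ∸ 1)) ℤ.+ sgn (b ∸ 1) ℤ.* + ((i ∸ 1) C (b ∸ 1))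
... | _ | _ | _ = 0ℤ

-- x_j ⊔⊔ w  (shuffle of a one-letter word with a word); this is the
-- specialisation of the defining recursion to 𝔞 = x_j, written separately so
-- that it is structurally recursive.
sh1 : ℕ → ℕ → Word → Poly
sh1 q j [] = word (j ∷ [])
sh1 q j (b ∷ bs) =
  word (j ∷ b ∷ bs) ++ (pre b (sh1 q j bs) ++
    (word ((j ℕ.+ b) ∷ bs) ++
     concatMap (λ k → scale (Δ q j b k) (pre ((j ℕ.+ b) ∸ k) (sh1 q k bs)))
               (upTo (suc (j ℕ.+ b)))))

sh1P : ℕ → ℕ → Poly → Poly
sh1P q k = concatMap (λ { (c , w) → scale c (sh1 q k w) })

-- 𝔞 ⊔⊔ 𝔟 on words, for the field with q elements.  The diamond part
-- 𝔞 ◇ 𝔟 = x_{a+b}(𝔞₋ ⊔⊔ 𝔟₋) + Σ_{i+j=a+b} Δ^j_{a,b} x_i (x_j ⊔⊔ (𝔞₋ ⊔⊔ 𝔟₋))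
-- is inlined (j ranges over 0..a+b, i = a+b-j).
sh : ℕ → Word → Word → Poly
sh q [] w = word w
sh q (a ∷ as) [] = word (a ∷ as)
sh q (a ∷ as) (b ∷ bs) =
  pre a (sh q as (b ∷ bs)) ++ (pre b (sh q (a ∷ as) bs) ++
    (pre (a ℕ.+ b) S ++
     concatMap (λ j → scale (Δ q a b j) (pre ((a ℕ.+ b) ∸ j) (sh1P q j S)))
               (upTo (suc (a ℕ.+ b)))))
  where
  S : Poly
  S = sh q as bs

shP : ℕ → Poly → Poly → Poly
shP q P Q = concatMap (λ { (c , u) → concatMap (λ { (d , v) → scale (c ℤ.* d) (sh q u v) }) Q }) P

shPow : ℕ → ℕ → Poly
shPow q zero = word []
shPow q (suc n) = shP q (word ((q ∸ 1) ∷ [])) (shPow q n)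

coeff : Poly → Word → ℤ
coeff [] w = 0ℤ
coeff ((c , u) ∷ P) w with ≡-dec ℕ._≟_ u w
... | yes _ = c ℤ.+ coeff P w
... | no _ = coeff P w

-- equality in 𝔽_p⟨Σ⟩ ⊆ 𝔽_q⟨Σ⟩: all coefficients agree modulo p
_≈[_]_ : Poly → ℕ → Poly → Set
P ≈[ p ] Q = ∀ (w : Word) → (+ p) ℤD.∣ (coeff P w ℤ.- coeff Q w)

module Submission where

open import Defs
open import Data.Nat using (ℕ; _+_; _*_; _∸_; _^_; _≤_)
open import Data.Nat.Primality using (Prime)
open import Data.List using (_∷_; [])
open import Data.Product using (_×_)

open import Data.Nat using (zero; suc; _<_; s≤s; z≤n; NonZero; _≟_; _<?_; >-nonZero; nonTrivial⇒n>1)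
open import Data.Nat.Properties
open import Data.Nat.Divisibility
  using ( _∣_; _∣?_; divides; _∣0; 1∣_; ∣-trans; m∣m*n; n∣m*n; ∣m⇒∣m*n; ∣m∣n⇒∣m+n; ∣m+n∣m⇒∣n
        ; ∣⇒≤; ∣1⇒≡1; *-monoʳ-∣; *-cancelˡ-∣)
open import Data.Nat.Combinatorics using (_C_; nC1≡n; nCn≡1; k>n⇒nCk≡0; nCk+nC[k+1]≡[n+1]C[k+1])
open import Data.Nat.Primality
  using (euclidsLemma; prime⇒nonZero; prime⇒nonTrivial; prime⇒irreducible; prime[2])
open import Data.Nat.Tactic.RingSolver using (solve-∀)
open import Data.Integer as ℤ using (ℤ; +_; 0ℤ; 1ℤ; -1ℤ; -_)
import Data.Integer.Properties as ℤ
import Data.Integer.Divisibility.Signed as ℤ∣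
open ℤ∣ using (divides) renaming (_∣_ to _∣ℤ_)
import Data.Integer.Tactic.RingSolver as ℤ-Solver
open import Data.List using (List; _++_; concatMap; upTo; length)
open import Data.List.Properties using (≡-dec; upTo-∷ʳ)
open import Data.Product using (∃; _,_; proj₁; proj₂)
open import Data.Sum using (_⊎_; inj₁; inj₂)
open import Level using (0ℓ)
open import Relation.Binary.Bundles using (Setoid)
open import Relation.Binary.Definitions using (tri<; tri≈; tri>)
open import Relation.Binary.PropositionalEquality
import Relation.Binary.Reasoning.Setoid as SetoidReasoning
open import Relation.Binary.Structures using (IsEquivalence)
open import Relation.Nullary using (¬_; contradiction; yes; no)
open import Relation.Nullary.Decidable using (_×-dec_)

-- Expanding the recursion, x_a ⊔⊔ x_b = x_{a+b} + Σ_{j ≤ a+b} c_j x_{a+b-j} x_j with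
-- c_j = δ_{j,b} + δ_{j,a} + Δ^j_{a,b}.  For a = αn and b = βn, where n = q - 1, every c_j
-- vanishes modulo p.  Off the multiples of n only the δ's could contribute, and they do not.
-- At j = γn, Δ^j_{a,b} = (-1)^{a-1} C(γn-1, a-1) + (-1)^{b-1} C(γn-1, b-1), and each summand
-- cancels the δ belonging to it: for γ < α both vanish; for γ = α we get 1 + (-1)^{αn-1},
-- which is 0 because αn - 1 is odd unless p = 2; for γ > α the q-adic digits
-- γn - 1 = (γ-1)q + (n-γ) and αn - 1 = (α-1)q + (n-α) satisfy n - γ < n - α, which forces
-- p ∣ C(γn-1, αn-1).  Thus x_{αn} ⊔⊔ x_{βn} ≡ x_{(α+β)n}, and the claim about powers of
-- x_{q-1} follows by induction, because shuffling with a fixed word is linear and hence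
-- respects congruence modulo p.

-- Binomial coefficients modulo p

[k+1]*[n+1]C[k+1]≡[n+1]*nCk : ∀ n k → suc k * (suc n C suc k) ≡ suc n * (n C k)
[k+1]*[n+1]C[k+1]≡[n+1]*nCk zero    zero    = refl
[k+1]*[n+1]C[k+1]≡[n+1]*nCk zero    (suc k) = *-zeroʳ (2 + k)
[k+1]*[n+1]C[k+1]≡[n+1]*nCk (suc n) zero    =
  trans (+-identityʳ _) (trans (nC1≡n (2 + n)) (sym (*-identityʳ (2 + n))))
[k+1]*[n+1]C[k+1]≡[n+1]*nCk (suc n) (suc k) = begin
  (2 + k) * ((2 + n) C (2 + k))                        ≡⟨ cong ((2 + k) *_) (sym (pascal (1 + n) (1 + k))) ⟩
  (2 + k) * (X + Y)                                    ≡⟨ regroup k X Y ⟩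
  (1 + k) * X + X + (2 + k) * Y                        ≡⟨ cong₂ (λ u v → u + X + v) IH IH′ ⟩
  (1 + n) * nCk + X + (1 + n) * nC[k+1]                ≡⟨ cong (λ u → (1 + n) * nCk + u + (1 + n) * nC[k+1])
                                                               (sym (pascal n k)) ⟩
  (1 + n) * nCk + (nCk + nC[k+1]) + (1 + n) * nC[k+1]  ≡⟨ collect n nCk nC[k+1] ⟩
  (2 + n) * (nCk + nC[k+1])                            ≡⟨ cong ((2 + n) *_) (pascal n k) ⟩
  (2 + n) * ((1 + n) C (1 + k))                        ∎
  where
  open ≡-Reasoning
  pascal : ∀ n k → n C k + n C suc k ≡ suc n C suc k
  pascal = nCk+nC[k+1]≡[n+1]C[k+1]
  X Y nCk nC[k+1] : ℕ
  X = suc n C suc k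
  Y = suc n C suc (suc k)
  nCk = n C k
  nC[k+1] = n C suc k
  IH : (1 + k) * X ≡ (1 + n) * nCk
  IH = [k+1]*[n+1]C[k+1]≡[n+1]*nCk n k
  IH′ : (2 + k) * Y ≡ (1 + n) * nC[k+1]
  IH′ = [k+1]*[n+1]C[k+1]≡[n+1]*nCk n (suc k)
  regroup : ∀ k x y → (2 + k) * (x + y) ≡ (1 + k) * x + x + (2 + k) * y
  regroup = solve-∀
  collect : ∀ n x y → (1 + n) * x + (x + y) + (1 + n) * y ≡ (2 + n) * (x + y)
  collect = solve-∀

[a+1]*n∸1≡a*[n+1]+[n∸[a+1]] : ∀ {a n} → suc a ≤ n → suc a * n ∸ 1 ≡ a * suc n + (n ∸ suc a)
[a+1]*n∸1≡a*[n+1]+[n∸[a+1]] {a} {n} a<n = begin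
  suc a * n ∸ 1               ≡⟨ cong (λ m → suc a * m ∸ 1) (sym a+1+t≡n) ⟩
  suc a * (suc a + t) ∸ 1     ≡⟨ expand a t ⟩
  a * suc (suc a + t) + t     ≡⟨ cong (λ m → a * suc m + t) a+1+t≡n ⟩
  a * suc n + t               ∎
  where
  open ≡-Reasoning
  t : ℕ
  t = n ∸ suc a
  a+1+t≡n : suc a + t ≡ n
  a+1+t≡n = m+[n∸m]≡n a<n
  expand : ∀ a t → a + t + a * suc (a + t) ≡ a * suc (suc (a + t)) + t
  expand = solve-∀

module _ {p : ℕ} (p-prime : Prime p) where

  private instance
    p≢0 : NonZero p
    p≢0 = prime⇒nonZero p-prime

  pʲ∣m*n∧pʲ∤m⇒p∣n : ∀ j {m n} → p ^ j ∣ m * n → ¬ (p ^ j ∣ m) → p ∣ n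
  pʲ∣m*n∧pʲ∤m⇒p∣n zero    {m}     _     pʲ∤m = contradiction (1∣ m) pʲ∤m
  pʲ∣m*n∧pʲ∤m⇒p∣n (suc j) {m} {n} pʲ∣mn pʲ∤m
    with euclidsLemma m n p-prime (∣-trans (m∣m*n (p ^ j)) pʲ∣mn)
  ... | inj₂ p∣n = p∣n
  ... | inj₁ (divides m′ refl) = pʲ∣m*n∧pʲ∤m⇒p∣n j
          (*-cancelˡ-∣ p (subst (p * p ^ j ∣_) (swap m′ p n) pʲ∣mn))
          (λ pʲ∣m′ → pʲ∤m (subst (p * p ^ j ∣_) (*-comm p m′) (*-monoʳ-∣ p pʲ∣m′)))
    where
    swap : ∀ x y z → x * y * z ≡ y * (x * z)
    swap = solve-∀

  pᵏ∣n∧pᵏ∤i⇒p∣nCi : ∀ k {n i} → p ^ k ∣ n → ¬ (p ^ k ∣ i) → p ∣ n C i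
  pᵏ∣n∧pᵏ∤i⇒p∣nCi k {n}     {zero}  _   pᵏ∤0 = contradiction ((p ^ k) ∣0) pᵏ∤0
  pᵏ∣n∧pᵏ∤i⇒p∣nCi k {zero}  {suc i} _   _    = p ∣0
  pᵏ∣n∧pᵏ∤i⇒p∣nCi k {suc n} {suc i} pᵏ∣n pᵏ∤i = pʲ∣m*n∧pʲ∤m⇒p∣n k
    (subst (p ^ k ∣_) (sym ([k+1]*[n+1]C[k+1]≡[n+1]*nCk n i)) (∣m⇒∣m*n (n C i) pᵏ∣n)) pᵏ∤i

  -- Pascal's rule lowers r and t together, down to r = 0, where q divides the top but not the bottom.
  p∣[m*q+r]C[s*q+t] : ∀ k m s {r t} → r < t → t < p ^ k → p ∣ (m * p ^ k + r) C (s * p ^ k + t)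
  p∣[m*q+r]C[s*q+t] k m s {zero} {suc t} _ t<q =
    pᵏ∣n∧pᵏ∤i⇒p∣nCi k (subst (p ^ k ∣_) (sym (+-identityʳ _)) (n∣m*n m))
      (λ q∣sq+t → <⇒≱ t<q (∣⇒≤ (∣m+n∣m⇒∣n q∣sq+t (n∣m*n s))))
  p∣[m*q+r]C[s*q+t] k m s {suc r} {suc t} (s≤s r<t) t<q =
    subst (p ∣_) pascal
      (∣m∣n⇒∣m+n (p∣[m*q+r]C[s*q+t] k m s r<t (<-trans (n<1+n t) t<q))
                 (p∣[m*q+r]C[s*q+t] k m s (m<n⇒m<1+n r<t) t<q))
    where
    pascal : (m * p ^ k + r) C (s * p ^ k + t) + (m * p ^ k + r) C (s * p ^ k + suc t)
           ≡ (m * p ^ k + suc r) C (s * p ^ k + suc t)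
    pascal rewrite +-suc (m * p ^ k) r | +-suc (s * p ^ k) t =
      nCk+nC[k+1]≡[n+1]C[k+1] (m * p ^ k + r) (s * p ^ k + t)

  p∣[γn∸1]C[αn∸1] : ∀ k {n} → suc n ≡ p ^ k → ∀ {α γ} → 1 ≤ α → α < γ → γ ≤ n →
                    p ∣ (γ * n ∸ 1) C (α * n ∸ 1)
  p∣[γn∸1]C[αn∸1] k {n} n+1≡q {suc a} {suc g} _ (s≤s a<g) γ≤n
    rewrite [a+1]*n∸1≡a*[n+1]+[n∸[a+1]] γ≤n
          | [a+1]*n∸1≡a*[n+1]+[n∸[a+1]] (≤-trans (s≤s (<⇒≤ a<g)) γ≤n)
          | n+1≡q
    = p∣[m*q+r]C[s*q+t] k g a (∸-monoʳ-< (s≤s a<g) γ≤n)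
        (subst (n ∸ suc a <_) n+1≡q (s≤s (m∸n≤m n (suc a))))

even⊎odd : ∀ m → ∃ λ j → m ≡ j + j ⊎ m ≡ suc (j + j)
even⊎odd zero = 0 , inj₁ refl
even⊎odd (suc m) with even⊎odd m
... | j , inj₁ refl = j , inj₂ refl
... | j , inj₂ refl = suc j , inj₁ (cong suc (sym (+-suc j j)))

prime∣mᵏ⇒prime∣m : ∀ {d} m k → Prime d → d ∣ m ^ k → d ∣ m
prime∣mᵏ⇒prime∣m m zero    d-prime d∣1 with ∣1⇒≡1 d∣1
... | refl = contradiction d-prime (λ ())
prime∣mᵏ⇒prime∣m m (suc k) d-prime d∣mᵏ⁺¹ with euclidsLemma m (m ^ k) d-prime d∣mᵏ⁺¹
... | inj₁ d∣m  = d∣m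
... | inj₂ d∣mᵏ = prime∣mᵏ⇒prime∣m m k d-prime d∣mᵏ

sgn[m+m]≡1 : ∀ m → sgn (m + m) ≡ 1ℤ
sgn[m+m]≡1 zero    = refl
sgn[m+m]≡1 (suc m) rewrite +-suc m m = trans (ℤ.neg-involutive _) (sgn[m+m]≡1 m)

sgn[m+m∸1]≡-1 : ∀ {m} → 1 ≤ m → sgn (m + m ∸ 1) ≡ -1ℤ
sgn[m+m∸1]≡-1 {suc t} _ rewrite +-suc t t = cong -_ (sgn[m+m]≡1 t)

2∣sgn+1 : ∀ m → + 2 ∣ℤ sgn m ℤ.+ 1ℤ
2∣sgn+1 zero          = divides 1ℤ refl
2∣sgn+1 (suc zero)    = divides 0ℤ refl
2∣sgn+1 (suc (suc m)) rewrite ℤ.neg-involutive (sgn m) = 2∣sgn+1 m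

p∣sgn[αn∸1]+1 : ∀ {p} → Prime p → ∀ k {n} → suc n ≡ p ^ k → 1 ≤ n →
                ∀ {α} → 1 ≤ α → + p ∣ℤ sgn (α * n ∸ 1) ℤ.+ 1ℤ
p∣sgn[αn∸1]+1 {p} p-prime k {n} n+1≡q n≥1 {α} α≥1 with even⊎odd n
... | j , inj₁ refl = divides 0ℤ (cong (ℤ._+ 1ℤ) sgn≡-1)
  where
  j≥1 : ∀ {j} → 1 ≤ j + j → 1 ≤ j
  j≥1 {suc _} _ = s≤s z≤n
  sgn≡-1 : sgn (α * (j + j) ∸ 1) ≡ -1ℤ
  sgn≡-1 = subst (λ m → sgn (m ∸ 1) ≡ -1ℤ) (sym (*-distribˡ-+ α j j))
                 (sgn[m+m∸1]≡-1 (*-mono-≤ α≥1 (j≥1 n≥1)))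
... | j , inj₂ refl with prime⇒irreducible p-prime (prime∣mᵏ⇒prime∣m p k prime[2] 2∣q)
  where
  double : ∀ x → 2 + (x + x) ≡ (1 + x) * 2
  double = solve-∀
  2∣q : 2 ∣ p ^ k
  2∣q = divides (suc j) (trans (sym n+1≡q) (double j))
... | inj₂ refl = 2∣sgn+1 (α * n ∸ 1)

-- The coefficients of x_a ⊔⊔ x_b

δ : ℕ → ℕ → ℤ
δ i j with i ≟ j
... | yes _ = 1ℤ
... | no  _ = 0ℤ

δ-refl : ∀ i → δ i i ≡ 1ℤ
δ-refl i with i ≟ i
... | yes _   = refl
... | no  i≢i = contradiction refl i≢i

δ-≢ : ∀ {i j} → i ≢ j → δ i j ≡ 0ℤ
δ-≢ {i} {j} i≢j with i ≟ j
... | yes i≡j = contradiction i≡j i≢j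
... | no  _   = refl

signedBinomial : ℕ → ℕ → ℤ
signedBinomial a i = sgn (a ∸ 1) ℤ.* + ((i ∸ 1) C (a ∸ 1))

Δ≡signedBinomials : ∀ q a b i → q ∸ 1 ∣ i × 0 < i × i < a + b →
                    Δ q a b i ≡ signedBinomial a i ℤ.+ signedBinomial b i
Δ≡signedBinomials q a b i (n∣i , i>0 , i<a+b) with (q ∸ 1) ∣? i | 0 <? i | i <? a + b
... | yes _   | yes _   | yes _     = refl
... | no  n∤i | _       | _         = contradiction n∣i n∤i
... | yes _   | no  i≯0 | _         = contradiction i>0 i≯0
... | yes _   | yes _   | no  i≮a+b = contradiction i<a+b i≮a+b

Δ≡0 : ∀ q a b i → ¬ (q ∸ 1 ∣ i × 0 < i × i < a + b) → Δ q a b i ≡ 0ℤ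
Δ≡0 q a b i ¬support with (q ∸ 1) ∣? i | 0 <? i | i <? a + b
... | yes n∣i | yes i>0 | yes i<a+b = contradiction (n∣i , i>0 , i<a+b) ¬support
... | no  _   | _       | _         = refl
... | yes _   | no  _   | _         = refl
... | yes _   | yes _   | no  _     = refl

twoLetterCoeff : ℕ → ℕ → ℕ → ℕ → ℤ
twoLetterCoeff q a b j = δ j b ℤ.+ δ j a ℤ.+ Δ q a b j

∑ : {A : Set} → List A → (A → ℤ) → ℤ
∑ []       f = 0ℤ
∑ (x ∷ xs) f = f x ℤ.+ ∑ xs f

∑-cong : ∀ {A : Set} (xs : List A) {f g : A → ℤ} → (∀ x → f x ≡ g x) → ∑ xs f ≡ ∑ xs g
∑-cong []       f≗g = refl
∑-cong (x ∷ xs) f≗g = cong₂ ℤ._+_ (f≗g x) (∑-cong xs f≗g)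

∑-++ : ∀ {A : Set} (xs ys : List A) f → ∑ (xs ++ ys) f ≡ ∑ xs f ℤ.+ ∑ ys f
∑-++ []       ys f = sym (ℤ.+-identityˡ _)
∑-++ (x ∷ xs) ys f = trans (cong (ℤ._+_ (f x)) (∑-++ xs ys f)) (sym (ℤ.+-assoc (f x) _ _))

∑-+ : ∀ {A : Set} (xs : List A) f g → ∑ xs (λ x → f x ℤ.+ g x) ≡ ∑ xs f ℤ.+ ∑ xs g
∑-+ []       f g = refl
∑-+ (x ∷ xs) f g = trans (cong (ℤ._+_ (f x ℤ.+ g x)) (∑-+ xs f g)) (interchange (f x) (g x) _ _)
  where
  interchange : ∀ a b c d → a ℤ.+ b ℤ.+ (c ℤ.+ d) ≡ a ℤ.+ c ℤ.+ (b ℤ.+ d)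
  interchange = ℤ-Solver.solve-∀

∑-divisible : ∀ {A : Set} {d} (xs : List A) (c s : A → ℤ) →
              (∀ x → d ∣ℤ c x) → d ∣ℤ ∑ xs (λ x → c x ℤ.* s x)
∑-divisible []       c s d∣c = divides 0ℤ refl
∑-divisible (x ∷ xs) c s d∣c = ℤ∣.∣m∣n⇒∣m+n (ℤ∣.∣m⇒∣m*n (s x) (d∣c x)) (∑-divisible xs c s d∣c)

∑-upTo-suc : ∀ N f → ∑ (upTo (suc N)) f ≡ ∑ (upTo N) f ℤ.+ f N
∑-upTo-suc N f = begin
  ∑ (upTo (suc N)) f                 ≡⟨ cong (λ xs → ∑ xs f) (upTo-∷ʳ N) ⟨
  ∑ (upTo N ++ N ∷ []) f             ≡⟨ ∑-++ (upTo N) (N ∷ []) f ⟩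
  ∑ (upTo N) f ℤ.+ (f N ℤ.+ 0ℤ)      ≡⟨ cong (ℤ._+_ (∑ (upTo N) f)) (ℤ.+-identityʳ (f N)) ⟩
  ∑ (upTo N) f ℤ.+ f N               ∎
  where open ≡-Reasoning

∑-δ-≥ : ∀ N {b} (s : ℕ → ℤ) → N ≤ b → ∑ (upTo N) (λ j → δ j b ℤ.* s j) ≡ 0ℤ
∑-δ-≥ zero        s _   = refl
∑-δ-≥ (suc N) {b} s N<b = begin
  ∑ (upTo (suc N)) (λ j → δ j b ℤ.* s j)              ≡⟨ ∑-upTo-suc N (λ j → δ j b ℤ.* s j) ⟩
  ∑ (upTo N) (λ j → δ j b ℤ.* s j) ℤ.+ δ N b ℤ.* s N  ≡⟨ cong₂ (λ x y → x ℤ.+ y ℤ.* s N)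
                                                               (∑-δ-≥ N s (<⇒≤ N<b)) (δ-≢ (<⇒≢ N<b)) ⟩
  0ℤ                                                   ∎
  where open ≡-Reasoning

∑-δ : ∀ N {b} (s : ℕ → ℤ) → b < N → ∑ (upTo N) (λ j → δ j b ℤ.* s j) ≡ s b
∑-δ (suc N) {b} s b<N+1 rewrite ∑-upTo-suc N (λ j → δ j b ℤ.* s j)
  with m≤n⇒m<n∨m≡n (≤-pred b<N+1)
... | inj₁ b<N rewrite ∑-δ N s b<N | δ-≢ (>⇒≢ b<N) = ℤ.+-identityʳ (s b)
... | inj₂ refl rewrite ∑-δ-≥ N s ≤-refl | δ-refl N = trans (ℤ.+-identityˡ _) (ℤ.*-identityˡ (s N))

coeff-++ : ∀ P Q w → coeff (P ++ Q) w ≡ coeff P w ℤ.+ coeff Q w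
coeff-++ []            Q w = sym (ℤ.+-identityˡ _)
coeff-++ ((c , u) ∷ P) Q w with ≡-dec _≟_ u w
... | yes _ = trans (cong (ℤ._+_ c) (coeff-++ P Q w)) (sym (ℤ.+-assoc c _ _))
... | no  _ = coeff-++ P Q w

coeff-scale : ∀ c P w → coeff (scale c P) w ≡ c ℤ.* coeff P w
coeff-scale c []            w = sym (ℤ.*-zeroʳ c)
coeff-scale c ((d , u) ∷ P) w with ≡-dec _≟_ u w
... | yes _ = trans (cong (ℤ._+_ (c ℤ.* d)) (coeff-scale c P w)) (sym (ℤ.*-distribˡ-+ c d _))
... | no  _ = coeff-scale c P w

coeff-concatMap : ∀ {A : Set} (F : A → Poly) xs w →
                  coeff (concatMap F xs) w ≡ ∑ xs (λ x → coeff (F x) w)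
coeff-concatMap F []       w = refl
coeff-concatMap F (x ∷ xs) w = trans (coeff-++ (F x) (concatMap F xs) w)
                                     (cong (ℤ._+_ (coeff (F x) w)) (coeff-concatMap F xs w))

-- Only the words x_{a+b} and x_{a+b-j} x_j (j ≤ a + b) occur; x_a x_b and x_b x_a are the j = b and
-- j = a instances of the latter, which is where the two δ's in twoLetterCoeff come from.
coeff-x[a]⊔⊔x[b] : ∀ q a b w → coeff (sh q (a ∷ []) (b ∷ [])) w ≡
  coeff (word (a + b ∷ [])) w ℤ.+
  ∑ (upTo (suc (a + b))) (λ j → twoLetterCoeff q a b j ℤ.* coeff (word (a + b ∸ j ∷ j ∷ [])) w)
coeff-x[a]⊔⊔x[b] q a b w = begin
  coeff (sh q (a ∷ []) (b ∷ [])) w                         ≡⟨ shuffle-terms ⟩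
  s b ℤ.+ (s a ℤ.+ (x[a+b] ℤ.+ ∑Δs))                        ≡⟨ regroup (s b) (s a) x[a+b] ∑Δs ⟩
  x[a+b] ℤ.+ (s b ℤ.+ s a ℤ.+ ∑Δs)                          ≡⟨ cong (ℤ._+_ x[a+b]) diamond-terms ⟨
  x[a+b] ℤ.+ ∑ U (λ j → twoLetterCoeff q a b j ℤ.* s j)     ∎
  where
  open ≡-Reasoning
  U : List ℕ
  U = upTo (suc (a + b))
  s : ℕ → ℤ
  s j = coeff (word (a + b ∸ j ∷ j ∷ [])) w
  x[a+b] ∑Δs : ℤ
  x[a+b] = coeff (word (a + b ∷ [])) w
  ∑Δs = ∑ U (λ j → Δ q a b j ℤ.* s j)

  regroup : ∀ u v x d → u ℤ.+ (v ℤ.+ (x ℤ.+ d)) ≡ x ℤ.+ (u ℤ.+ v ℤ.+ d)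
  regroup = ℤ-Solver.solve-∀
  distrib : ∀ u v d s → (u ℤ.+ v ℤ.+ d) ℤ.* s ≡ u ℤ.* s ℤ.+ v ℤ.* s ℤ.+ d ℤ.* s
  distrib = ℤ-Solver.solve-∀

  shuffle-terms : coeff (sh q (a ∷ []) (b ∷ [])) w ≡ s b ℤ.+ (s a ℤ.+ (x[a+b] ℤ.+ ∑Δs))
  shuffle-terms =
    trans (coeff-++ (word (a ∷ b ∷ [])) _ w) (cong₂ ℤ._+_
      (cong (λ m → coeff (word (m ∷ b ∷ [])) w) (sym (m+n∸n≡m a b)))
      (trans (coeff-++ (word (b ∷ a ∷ [])) _ w) (cong₂ ℤ._+_
        (cong (λ m → coeff (word (m ∷ a ∷ [])) w) (sym (m+n∸m≡n a b)))
        (trans (coeff-++ (word (a + b ∷ [])) _ w) (cong (ℤ._+_ x[a+b])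
          (trans (coeff-concatMap (λ j → scale (Δ q a b j) (word (a + b ∸ j ∷ j ∷ []))) U w)
                 (∑-cong U (λ j → coeff-scale (Δ q a b j) (word (a + b ∸ j ∷ j ∷ [])) w))))))))

  diamond-terms : ∑ U (λ j → twoLetterCoeff q a b j ℤ.* s j) ≡ s b ℤ.+ s a ℤ.+ ∑Δs
  diamond-terms = begin
    ∑ U (λ j → twoLetterCoeff q a b j ℤ.* s j)
      ≡⟨ ∑-cong U (λ j → distrib (δ j b) (δ j a) (Δ q a b j) (s j)) ⟩
    ∑ U (λ j → δ j b ℤ.* s j ℤ.+ δ j a ℤ.* s j ℤ.+ Δ q a b j ℤ.* s j)
      ≡⟨ ∑-+ U (λ j → δ j b ℤ.* s j ℤ.+ δ j a ℤ.* s j) (λ j → Δ q a b j ℤ.* s j) ⟩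
    ∑ U (λ j → δ j b ℤ.* s j ℤ.+ δ j a ℤ.* s j) ℤ.+ ∑Δs
      ≡⟨ cong (λ y → y ℤ.+ ∑Δs) (∑-+ U (λ j → δ j b ℤ.* s j) (λ j → δ j a ℤ.* s j)) ⟩
    ∑ U (λ j → δ j b ℤ.* s j) ℤ.+ ∑ U (λ j → δ j a ℤ.* s j) ℤ.+ ∑Δs
      ≡⟨ cong₂ (λ y z → y ℤ.+ z ℤ.+ ∑Δs) (∑-δ (suc (a + b)) s (s≤s (m≤n+m b a)))
                                          (∑-δ (suc (a + b)) s (s≤s (m≤m+n a b))) ⟩
    s b ℤ.+ s a ℤ.+ ∑Δs ∎

≈⇒∣ : ∀ {p P Q} → P ≈[ p ] Q → ∀ w → + p ∣ℤ coeff P w ℤ.- coeff Q w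
≈⇒∣ {P = P} {Q} P≈Q w = ℤ∣.∣ᵤ⇒∣ {i = coeff P w ℤ.- coeff Q w} (P≈Q w)

∣⇒≈ : ∀ {p P Q} → (∀ w → + p ∣ℤ coeff P w ℤ.- coeff Q w) → P ≈[ p ] Q
∣⇒≈ {P = P} {Q} p∣P-Q w = ℤ∣.∣⇒∣ᵤ {i = coeff P w ℤ.- coeff Q w} (p∣P-Q w)

coeffwise⇒≈ : ∀ {p P Q} → (∀ w → coeff P w ≡ coeff Q w) → P ≈[ p ] Q
coeffwise⇒≈ {p} {P} {Q} P≗Q = ∣⇒≈ {P = P} {Q} λ w →
  subst (+ p ∣ℤ_) (sym (ℤ.i≡j⇒i-j≡0 (P≗Q w))) (divides 0ℤ refl)

≈-isEquivalence : ∀ p → IsEquivalence (_≈[ p ]_)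
≈-isEquivalence p = record
  { refl  = λ {P} → coeffwise⇒≈ {P = P} {P} (λ _ → refl)
  ; sym   = λ {P} {Q} P≈Q w → subst (p ∣_) (ℤ.∣i-j∣≡∣j-i∣ (coeff P w) (coeff Q w)) (P≈Q w)
  ; trans = λ {P} {Q} {R} P≈Q Q≈R → ∣⇒≈ {P = P} {R} λ w →
      subst (+ p ∣ℤ_) (ℤ.+-minus-telescope (coeff P w) (coeff Q w) (coeff R w))
            (ℤ∣.∣m∣n⇒∣m+n (≈⇒∣ {P = P} {Q} P≈Q w) (≈⇒∣ {P = Q} {R} Q≈R w))
  }

≈-setoid : ℕ → Setoid 0ℓ 0ℓ
≈-setoid p = record { Carrier = Poly ; _≈_ = _≈[ p ]_ ; isEquivalence = ≈-isEquivalence p }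

x[a]⊔⊔x[b]≈x[a+b] : ∀ {p} q a b → (∀ j → + p ∣ℤ twoLetterCoeff q a b j) →
                    sh q (a ∷ []) (b ∷ []) ≈[ p ] word (a + b ∷ [])
x[a]⊔⊔x[b]≈x[a+b] {p} q a b p∣coeffs = ∣⇒≈ {P = sh q (a ∷ []) (b ∷ [])} {word (a + b ∷ [])} λ w →
  subst (+ p ∣ℤ_)
    (sym (trans (cong (λ y → y ℤ.- coeff (word (a + b ∷ [])) w) (coeff-x[a]⊔⊔x[b] q a b w))
                (cancel (coeff (word (a + b ∷ [])) w) _)))
    (∑-divisible (upTo (suc (a + b))) (twoLetterCoeff q a b)
                 (λ j → coeff (word (a + b ∸ j ∷ j ∷ [])) w) p∣coeffs)
  where
  cancel : ∀ x y → x ℤ.+ y ℤ.- x ≡ y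
  cancel = ℤ-Solver.solve-∀

-- Linearity of shuffling

extend : (Word → ℤ) → Poly → ℤ
extend g P = ∑ P (λ cu → proj₁ cu ℤ.* g (proj₂ cu))

extend-scale : ∀ g c P → extend g (scale c P) ≡ c ℤ.* extend g P
extend-scale g c []            = sym (ℤ.*-zeroʳ c)
extend-scale g c ((d , u) ∷ P) = begin
  c ℤ.* d ℤ.* g u ℤ.+ extend g (scale c P)   ≡⟨ cong₂ ℤ._+_ (ℤ.*-assoc c d (g u)) (extend-scale g c P) ⟩
  c ℤ.* (d ℤ.* g u) ℤ.+ c ℤ.* extend g P     ≡⟨ ℤ.*-distribˡ-+ c (d ℤ.* g u) (extend g P) ⟨
  c ℤ.* (d ℤ.* g u ℤ.+ extend g P)           ∎
  where open ≡-Reasoning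

remove : Word → Poly → Poly
remove v []            = []
remove v ((c , u) ∷ P) with ≡-dec _≟_ u v
... | yes _ = remove v P
... | no  _ = (c , u) ∷ remove v P

remove-head : ∀ v c P → remove v ((c , v) ∷ P) ≡ remove v P
remove-head v c P with ≡-dec _≟_ v v
... | yes _   = refl
... | no  v≢v = contradiction refl v≢v

length-remove : ∀ v P → length (remove v P) ≤ length P
length-remove v []            = z≤n
length-remove v ((c , u) ∷ P) with ≡-dec _≟_ u v
... | yes _ = m≤n⇒m≤1+n (length-remove v P)
... | no  _ = s≤s (length-remove v P)

coeff-remove-self : ∀ v P → coeff (remove v P) v ≡ 0ℤ
coeff-remove-self v []            = refl
coeff-remove-self v ((c , u) ∷ P) with ≡-dec _≟_ u v
... | yes _ = coeff-remove-self v P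
... | no u≢v with ≡-dec _≟_ u v
...   | yes u≡v = contradiction u≡v u≢v
...   | no  _   = coeff-remove-self v P

coeff-remove : ∀ {v w} P → v ≢ w → coeff (remove v P) w ≡ coeff P w
coeff-remove []            v≢w = refl
coeff-remove {v} {w} ((c , u) ∷ P) v≢w with ≡-dec _≟_ u v
... | yes refl with ≡-dec _≟_ u w
...   | yes refl = contradiction refl v≢w
...   | no  _    = coeff-remove P v≢w
coeff-remove {v} {w} ((c , u) ∷ P) v≢w | no _ with ≡-dec _≟_ u w
...   | yes _ = cong (ℤ._+_ c) (coeff-remove P v≢w)
...   | no  _ = coeff-remove P v≢w

extend-split : ∀ g v P → extend g P ≡ coeff P v ℤ.* g v ℤ.+ extend g (remove v P)
extend-split g v []            = refl
extend-split g v ((c , u) ∷ P) with ≡-dec _≟_ u v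
... | yes refl =
  trans (cong (ℤ._+_ (c ℤ.* g u)) (extend-split g u P)) (collect c (coeff P u) (g u) _)
  where
  collect : ∀ a b x r → a ℤ.* x ℤ.+ (b ℤ.* x ℤ.+ r) ≡ (a ℤ.+ b) ℤ.* x ℤ.+ r
  collect = ℤ-Solver.solve-∀
... | no  _ =
  trans (cong (ℤ._+_ (c ℤ.* g u)) (extend-split g v P)) (swap (c ℤ.* g u) (coeff P v ℤ.* g v) _)
  where
  swap : ∀ a b r → a ℤ.+ (b ℤ.+ r) ≡ b ℤ.+ (a ℤ.+ r)
  swap = ℤ-Solver.solve-∀

-- Induction on the number N of terms: all terms of the leading word v are split off at once.
extend-divisible : ∀ {d} g N P → length P ≤ N → (∀ w → d ∣ℤ coeff P w) → d ∣ℤ extend g P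
extend-divisible g N [] _ _ = divides 0ℤ refl
extend-divisible {d} g (suc N) P@((c , v) ∷ P′) (s≤s |P′|≤N) d∣P =
  subst (d ∣ℤ_) (sym (extend-split g v P))
    (ℤ∣.∣m∣n⇒∣m+n (ℤ∣.∣m⇒∣m*n (g v) (d∣P v)) (extend-divisible g N (remove v P) |P∖v|≤N d∣P∖v))
  where
  |P∖v|≤N : length (remove v P) ≤ N
  |P∖v|≤N = subst (λ R → length R ≤ N) (sym (remove-head v c P′)) (≤-trans (length-remove v P′) |P′|≤N)
  d∣P∖v : ∀ w → d ∣ℤ coeff (remove v P) w
  d∣P∖v w with ≡-dec _≟_ v w
  ... | yes refl = subst (d ∣ℤ_) (sym (coeff-remove-self v P)) (divides 0ℤ refl)
  ... | no  v≢w  = subst (d ∣ℤ_) (sym (coeff-remove P v≢w)) (d∣P w)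

extend-cong : ∀ {p} g {P Q} → P ≈[ p ] Q → + p ∣ℤ extend g P ℤ.- extend g Q
extend-cong {p} g {P} {Q} P≈Q = subst (+ p ∣ℤ_) extend-difference
  (extend-divisible g (length P-Q) P-Q ≤-refl λ w →
    subst (+ p ∣ℤ_) (sym (coeff-difference w)) (≈⇒∣ {P = P} {Q} P≈Q w))
  where
  P-Q : Poly
  P-Q = P ++ scale -1ℤ Q
  extend-difference : extend g P-Q ≡ extend g P ℤ.- extend g Q
  extend-difference = trans (∑-++ P (scale -1ℤ Q) _)
    (cong (ℤ._+_ (extend g P)) (trans (extend-scale g -1ℤ Q) (ℤ.-1*i≡-i (extend g Q))))
  coeff-difference : ∀ w → coeff P-Q w ≡ coeff P w ℤ.- coeff Q w
  coeff-difference w = trans (coeff-++ P (scale -1ℤ Q) w)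
    (cong (ℤ._+_ (coeff P w)) (trans (coeff-scale -1ℤ Q w) (ℤ.-1*i≡-i (coeff Q w))))

coeff-shP-word : ∀ q u Q w → coeff (shP q (word u) Q) w ≡ extend (λ v → coeff (sh q u v) w) Q
coeff-shP-word q u Q w = begin
  coeff (shP q (word u) Q) w             ≡⟨⟩
  coeff (concatMap F Q ++ []) w          ≡⟨ coeff-++ (concatMap F Q) [] w ⟩
  coeff (concatMap F Q) w ℤ.+ 0ℤ         ≡⟨ ℤ.+-identityʳ _ ⟩
  coeff (concatMap F Q) w                ≡⟨ coeff-concatMap F Q w ⟩
  ∑ Q (λ dv → coeff (F dv) w)            ≡⟨ ∑-cong Q coeff-F ⟩
  extend (λ v → coeff (sh q u v) w) Q    ∎
  where
  open ≡-Reasoning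
  F : ℤ × Word → Poly
  F dv = scale (1ℤ ℤ.* proj₁ dv) (sh q u (proj₂ dv))
  coeff-F : ∀ dv → coeff (F dv) w ≡ proj₁ dv ℤ.* coeff (sh q u (proj₂ dv)) w
  coeff-F (d , v) = trans (coeff-scale (1ℤ ℤ.* d) (sh q u v) w)
                          (cong (ℤ._* coeff (sh q u v) w) (ℤ.*-identityˡ d))

shP-word-word : ∀ {p} q u v → shP q (word u) (word v) ≈[ p ] sh q u v
shP-word-word q u v = coeffwise⇒≈ {P = shP q (word u) (word v)} {sh q u v} λ w →
  trans (coeff-shP-word q u (word v) w) (trans (ℤ.+-identityʳ _) (ℤ.*-identityˡ _))

shP-word-congʳ : ∀ {p} q u Q Q′ → Q ≈[ p ] Q′ → shP q (word u) Q ≈[ p ] shP q (word u) Q′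
shP-word-congʳ {p} q u Q Q′ Q≈Q′ = ∣⇒≈ {P = shP q (word u) Q} {shP q (word u) Q′} λ w →
  subst (+ p ∣ℤ_) (sym (cong₂ ℤ._-_ (coeff-shP-word q u Q w) (coeff-shP-word q u Q′ w)))
        (extend-cong (λ v → coeff (sh q u v) w) {Q} {Q′} Q≈Q′)

-- Letters whose indices are multiples of n = q - 1, q = p ^ k

module _ {p k : ℕ} (p-prime : Prime p) (k≥1 : 1 ≤ k) where

  private
    q n : ℕ
    q = p ^ k
    n = q ∸ 1

    instance
      p≢0 : NonZero p
      p≢0 = prime⇒nonZero p-prime

    q≥2 : 2 ≤ q
    q≥2 = ≤-trans (nonTrivial⇒n>1 p {{prime⇒nonTrivial p-prime}})
                  (subst (_≤ q) (*-identityʳ p) (^-monoʳ-≤ p k≥1))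

    n+1≡q : suc n ≡ q
    n+1≡q = m+[n∸m]≡n (≤-trans (s≤s z≤n) q≥2)

    n≥1 : 1 ≤ n
    n≥1 = ∸-monoˡ-≤ 1 q≥2

    instance
      n≢0 : NonZero n
      n≢0 = >-nonZero n≥1

  p∣δ+signedBinomial : ∀ {α γ} → 1 ≤ α → 1 ≤ γ → γ ≤ n →
                       + p ∣ℤ δ (γ * n) (α * n) ℤ.+ signedBinomial (α * n) (γ * n)
  p∣δ+signedBinomial {α} {γ} α≥1 γ≥1 γ≤n with <-cmp γ α
  ... | tri< γ<α _ _
    rewrite δ-≢ (<⇒≢ (*-monoˡ-< n γ<α))
          | k>n⇒nCk≡0 (∸-monoˡ-< (*-monoˡ-< n γ<α) (*-mono-≤ γ≥1 n≥1))
          | ℤ.*-zeroʳ (sgn (α * n ∸ 1))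
    = divides 0ℤ refl
  ... | tri≈ _ refl _
    rewrite δ-refl (α * n) | nCn≡1 (α * n ∸ 1)
          | ℤ.*-identityʳ (sgn (α * n ∸ 1)) | ℤ.+-comm 1ℤ (sgn (α * n ∸ 1))
    = p∣sgn[αn∸1]+1 p-prime k n+1≡q n≥1 α≥1
  ... | tri> _ _ α<γ
    rewrite δ-≢ (>⇒≢ (*-monoˡ-< n α<γ))
          | ℤ.+-identityˡ (signedBinomial (α * n) (γ * n))
    = ℤ∣.∣n⇒∣m*n (sgn (α * n ∸ 1)) (ℤ∣.∣ᵤ⇒∣ (p∣[γn∸1]C[αn∸1] p-prime k n+1≡q α≥1 α<γ γ≤n))

  p∣twoLetterCoeff : ∀ {α β} → 1 ≤ α → 1 ≤ β → α + β ≤ q →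
                     ∀ j → + p ∣ℤ twoLetterCoeff q (α * n) (β * n) j
  p∣twoLetterCoeff {α} {β} α≥1 β≥1 α+β≤q j with n ∣? j ×-dec (0 <? j ×-dec j <? α * n + β * n)
  ... | yes support@(divides γ refl , γn>0 , γn<αn+βn) =
    subst (+ p ∣ℤ_) (sym pair-off)
      (ℤ∣.∣m∣n⇒∣m+n (p∣δ+signedBinomial α≥1 γ≥1 γ≤n) (p∣δ+signedBinomial β≥1 γ≥1 γ≤n))
    where
    regroup : ∀ x y u v → x ℤ.+ y ℤ.+ (u ℤ.+ v) ≡ y ℤ.+ u ℤ.+ (x ℤ.+ v)
    regroup = ℤ-Solver.solve-∀
    pair-off : twoLetterCoeff q (α * n) (β * n) (γ * n)
             ≡ δ (γ * n) (α * n) ℤ.+ signedBinomial (α * n) (γ * n)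
               ℤ.+ (δ (γ * n) (β * n) ℤ.+ signedBinomial (β * n) (γ * n))
    pair-off = trans (cong (ℤ._+_ (δ (γ * n) (β * n) ℤ.+ δ (γ * n) (α * n)))
                           (Δ≡signedBinomials q (α * n) (β * n) (γ * n) support))
                     (regroup (δ (γ * n) (β * n)) (δ (γ * n) (α * n))
                              (signedBinomial (α * n) (γ * n)) (signedBinomial (β * n) (γ * n)))
    γ≥1 : 1 ≤ γ
    γ≥1 = *-cancelʳ-< n 0 γ γn>0
    γ<α+β : γ < α + β
    γ<α+β = *-cancelʳ-< n γ (α + β) (subst (γ * n <_) (sym (*-distribʳ-+ n α β)) γn<αn+βn)
    γ≤n : γ ≤ n
    γ≤n = ≤-pred (subst (γ <_) (sym n+1≡q) (<-≤-trans γ<α+β α+β≤q))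
  ... | no ¬support = subst (+ p ∣ℤ_) (sym vanishes) (divides 0ℤ refl)
    where
    outside-support : ∀ {α′ β′} → 1 ≤ α′ → 1 ≤ β′ → α′ * n + β′ * n ≡ α * n + β * n → j ≢ α′ * n
    outside-support {α′} {β′} α′≥1 β′≥1 eq refl = ¬support
      (n∣m*n α′ , *-mono-≤ α′≥1 n≥1 , subst (α′ * n <_) eq (m<m+n (α′ * n) (*-mono-≤ β′≥1 n≥1)))
    vanishes : twoLetterCoeff q (α * n) (β * n) j ≡ 0ℤ
    vanishes rewrite Δ≡0 q (α * n) (β * n) j ¬support
                   | δ-≢ (outside-support β≥1 α≥1 (+-comm (β * n) (α * n)))
                   | δ-≢ (outside-support α≥1 β≥1 refl)
      = refl

  x[αn]⊔⊔x[βn]≈x[[α+β]n] : ∀ {α β} → 1 ≤ α → 1 ≤ β → α + β ≤ q →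
                           sh q (α * n ∷ []) (β * n ∷ []) ≈[ p ] word ((α + β) * n ∷ [])
  x[αn]⊔⊔x[βn]≈x[[α+β]n] {α} {β} α≥1 β≥1 α+β≤q =
    subst (λ m → sh q (α * n ∷ []) (β * n ∷ []) ≈[ p ] word (m ∷ [])) (sym (*-distribʳ-+ n α β))
      (x[a]⊔⊔x[b]≈x[a+b] q (α * n) (β * n) (p∣twoLetterCoeff α≥1 β≥1 α+β≤q))

  shPow≈x[mn] : ∀ m → 1 ≤ m → m ≤ q → shPow q m ≈[ p ] word (m * n ∷ [])
  shPow≈x[mn] (suc zero) _ _ =
    subst (λ m → shPow q 1 ≈[ p ] word (m ∷ [])) (sym (*-identityˡ n)) (shP-word-word q (n ∷ []) [])
  shPow≈x[mn] (suc (suc m)) _ m+2≤q = begin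
    shP q (word (n ∷ [])) (shPow q (suc m))
      ≈⟨ shP-word-congʳ q (n ∷ []) (shPow q (suc m)) (word (suc m * n ∷ []))
                        (shPow≈x[mn] (suc m) (s≤s z≤n) (<⇒≤ m+2≤q)) ⟩
    shP q (word (n ∷ [])) (word (suc m * n ∷ []))
      ≈⟨ shP-word-word q (n ∷ []) (suc m * n ∷ []) ⟩
    sh q (n ∷ []) (suc m * n ∷ [])
      ≡⟨ cong (λ l → sh q (l ∷ []) (suc m * n ∷ [])) (*-identityˡ n) ⟨
    sh q (1 * n ∷ []) (suc m * n ∷ [])
      ≈⟨ x[αn]⊔⊔x[βn]≈x[[α+β]n] ≤-refl (s≤s z≤n) m+2≤q ⟩
    word (suc (suc m) * n ∷ [])
      ∎
    where open SetoidReasoning (≈-setoid p)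

lemma8p15 : (p k : ℕ) → Prime p → 1 ≤ k →
    (a b : ℕ) → 1 ≤ a → 1 ≤ b → a + b ≤ p ^ k →
    (sh (p ^ k) ((a * (p ^ k ∸ 1)) ∷ []) ((b * (p ^ k ∸ 1)) ∷ []) ≈[ p ] shPow (p ^ k) (a + b))
    × (shPow (p ^ k) (a + b) ≈[ p ] word (((a + b) * (p ^ k ∸ 1)) ∷ []))
lemma8p15 p k p-prime k≥1 a b a≥1 b≥1 a+b≤q = x[an]⊔⊔x[bn]≈shPow , shPow≈x[[a+b]n]
  where
  open SetoidReasoning (≈-setoid p)
  shPow≈x[[a+b]n] : shPow (p ^ k) (a + b) ≈[ p ] word ((a + b) * (p ^ k ∸ 1) ∷ [])
  shPow≈x[[a+b]n] = shPow≈x[mn] p-prime k≥1 (a + b) (≤-trans a≥1 (m≤m+n a b)) a+b≤q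
  x[an]⊔⊔x[bn]≈shPow : sh (p ^ k) (a * (p ^ k ∸ 1) ∷ []) (b * (p ^ k ∸ 1) ∷ []) ≈[ p ] shPow (p ^ k) (a + b)
  x[an]⊔⊔x[bn]≈shPow = begin
    sh (p ^ k) (a * (p ^ k ∸ 1) ∷ []) (b * (p ^ k ∸ 1) ∷ [])
      ≈⟨ x[αn]⊔⊔x[βn]≈x[[α+β]n] p-prime k≥1 a≥1 b≥1 a+b≤q ⟩
    word ((a + b) * (p ^ k ∸ 1) ∷ [])
      ≈⟨ shPow≈x[[a+b]n] ⟨
    shPow (p ^ k) (a + b)
      ∎
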